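{- Let $\mathbb K$ be the graph with vertex set $\{1,2,3,4,5\}$ and edge set $\{12,23,24,34,35,45\}$. If a graph $G$ contains $\mathbb K$ as an induced minor, then $G$ has a $\mathbb K$-model $\mathcal X=\{X_1,\dots,X_5\}$ such that $|X_1|=|X_5|=1$, $|N(X_1)\cap X_2|\le 3$, $|N(X_5)\cap X_3|\le 2$ and $|N(X_5)\cap X_4|\le 2$.
   Context: All graphs are finite and simple. A graph $G$ contains $H$ as an induced minor if $H$ can be obtained from $G$ by vertex deletions and edge contractions. For a graph $H$, an $H$-model in $G$ is a family $\{X_y: y\in V(H)\}$ of nonempty, pairwise disjoint, connected vertex subsets of $G$ such that for distinct $y,z$, $X_y$ and $X_z$ are joined by some edge of $G$ if and only if $yz\in E(H)$. For $S\subseteq V(G)$, $N(S)$ denotes the set of vertices of $G$ adjacent to some vertex of $S$. -}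

module Defs where

open import Data.Nat using (ℕ; zero; suc; _≤_)
open import Data.Bool using (Bool; true; false; _∧_; _∨_)
open import Data.Fin using (Fin; zero; suc)
open import Data.Fin.Subset using (Subset; _∈_; ∣_∣; _∩_; Nonempty)
open import Data.Vec using (tabulate)
open import Data.Product using (Σ; ∃; _×_; _,_)
open import Relation.Binary.PropositionalEquality using (_≡_; _≢_)
open import Relation.Nullary using (¬_)
open import Data.Empty using (⊥)
open import Function.Bundles using (_⇔_)

record Graph : Set where
  field
    n     : ℕ
    adj   : Fin n → Fin n → Bool
    sym   : ∀ u v → adj u v ≡ adj v u
    irrefl : ∀ u → adj u u ≡ false
open Graph public

Adj : (G : Graph) → Fin (n G) → Fin (n G) → Set
Adj G u v = adj G u v ≡ true

anyFin : {k : ℕ} → (Fin k → Bool) → Bool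
anyFin {zero}  f = false
anyFin {suc k} f = f zero ∨ anyFin (λ i → f (suc i))

N : (G : Graph) → Subset (n G) → Subset (n G)
N G S = tabulate (λ v → anyFin (λ u → Data.Vec.lookup S u ∧ adj G u v))
  where import Data.Vec

data Reach (G : Graph) (X : Subset (n G)) : Fin (n G) → Fin (n G) → Set where
  here : ∀ {u} → u ∈ X → Reach G X u u
  step : ∀ {u w v} → u ∈ X → Adj G u w → Reach G X w v → Reach G X u v

Connected : (G : Graph) → Subset (n G) → Set
Connected G X = ∀ u v → u ∈ X → v ∈ X → Reach G X u v

Disjoint : (G : Graph) → Subset (n G) → Subset (n G) → Set
Disjoint G X Y = ∀ v → v ∈ X → v ∈ Y → ⊥

Touch : (G : Graph) → Subset (n G) → Subset (n G) → Set
Touch G X Y = ∃ λ u → ∃ λ v → u ∈ X × v ∈ Y × Adj G u v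

record Model (H G : Graph) : Set where
  field
    X         : Fin (n H) → Subset (n G)
    nonempty  : ∀ y → Nonempty (X y)
    disjoint  : ∀ y z → y ≢ z → Disjoint G (X y) (X z)
    connected : ∀ y → Connected G (X y)
    edges     : ∀ y z → y ≢ z → (Touch G (X y) (X z) ⇔ Adj H y z)
open Model public

-- G contains H as an induced minor (equivalently: G has an H-model)
InducedMinor : (H G : Graph) → Set
InducedMinor H G = Model H G

-- The graph 𝕂: vertices 1..5 are Fin elements 0..4 (vertex i ↦ i-1),
-- edges 12,23,24,34,35,45.
kadj : Fin 5 → Fin 5 → Bool
kadj zero (suc zero) = true
kadj (suc zero) zero = true
kadj (suc zero) (suc (suc zero)) = true
kadj (suc (suc zero)) (suc zero) = true
kadj (suc zero) (suc (suc (suc zero))) = true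
kadj (suc (suc (suc zero))) (suc zero) = true
kadj (suc (suc zero)) (suc (suc (suc zero))) = true
kadj (suc (suc (suc zero))) (suc (suc zero)) = true
kadj (suc (suc zero)) (suc (suc (suc (suc zero)))) = true
kadj (suc (suc (suc (suc zero)))) (suc (suc zero)) = true
kadj (suc (suc (suc zero))) (suc (suc (suc (suc zero)))) = true
kadj (suc (suc (suc (suc zero)))) (suc (suc (suc zero))) = true
kadj _ _ = false

ksym : ∀ u v → kadj u v ≡ kadj v u
ksym u v = ksym' u v
  where
  open import Relation.Binary.PropositionalEquality using (refl)
  ksym' : ∀ u v → kadj u v ≡ kadj v u
  ksym' zero zero = refl
  ksym' zero (suc zero) = refl
  ksym' zero (suc (suc zero)) = refl
  ksym' zero (suc (suc (suc zero))) = refl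
  ksym' zero (suc (suc (suc (suc zero)))) = refl
  ksym' (suc zero) zero = refl
  ksym' (suc zero) (suc zero) = refl
  ksym' (suc zero) (suc (suc zero)) = refl
  ksym' (suc zero) (suc (suc (suc zero))) = refl
  ksym' (suc zero) (suc (suc (suc (suc zero)))) = refl
  ksym' (suc (suc zero)) zero = refl
  ksym' (suc (suc zero)) (suc zero) = refl
  ksym' (suc (suc zero)) (suc (suc zero)) = refl
  ksym' (suc (suc zero)) (suc (suc (suc zero))) = refl
  ksym' (suc (suc zero)) (suc (suc (suc (suc zero)))) = refl
  ksym' (suc (suc (suc zero))) zero = refl
  ksym' (suc (suc (suc zero))) (suc zero) = refl
  ksym' (suc (suc (suc zero))) (suc (suc zero)) = refl
  ksym' (suc (suc (suc zero))) (suc (suc (suc zero))) = refl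
  ksym' (suc (suc (suc zero))) (suc (suc (suc (suc zero)))) = refl
  ksym' (suc (suc (suc (suc zero)))) zero = refl
  ksym' (suc (suc (suc (suc zero)))) (suc zero) = refl
  ksym' (suc (suc (suc (suc zero)))) (suc (suc zero)) = refl
  ksym' (suc (suc (suc (suc zero)))) (suc (suc (suc zero))) = refl
  ksym' (suc (suc (suc (suc zero)))) (suc (suc (suc (suc zero)))) = refl

kirrefl : ∀ u → kadj u u ≡ false
kirrefl zero = Relation.Binary.PropositionalEquality.refl
  where import Relation.Binary.PropositionalEquality
kirrefl (suc zero) = Relation.Binary.PropositionalEquality.refl
  where import Relation.Binary.PropositionalEquality
kirrefl (suc (suc zero)) = Relation.Binary.PropositionalEquality.refl
  where import Relation.Binary.PropositionalEquality
kirrefl (suc (suc (suc zero))) = Relation.Binary.PropositionalEquality.refl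
  where import Relation.Binary.PropositionalEquality
kirrefl (suc (suc (suc (suc zero)))) = Relation.Binary.PropositionalEquality.refl
  where import Relation.Binary.PropositionalEquality

𝕂 : Graph
𝕂 = record { n = 5 ; adj = kadj ; sym = ksym ; irrefl = kirrefl }

k1 k2 k3 k4 k5 : Fin 5
k1 = zero
k2 = suc zero
k3 = suc (suc zero)
k4 = suc (suc (suc zero))
k5 = suc (suc (suc (suc zero)))

{-# OPTIONS --safe #-}
module Submission where

-- Write X₁, …, X₅ for the branch sets.  Both halves of the proof re-cut branch sets along
-- induced paths that meet the relevant neighbourhoods only at their ends.
--
-- X₁ becomes a single vertex.  Let D be an induced path in X₂ from N(X₃) to N(X₄).  If D
-- misses N(X₁), prolong it inside X₂ to a neighbour of some x ∈ X₁: then x has exactly one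
-- neighbour on the new X₂.  Otherwise take x ∈ X₁ adjacent to D.  Either x has at most two
-- neighbours on D, or it has neighbours on both sides of a neighbour b on D; in the latter case
-- {b} and {x} ∪ (D − b) replace X₁ and X₂, and b sees only x and its two path-neighbours.
--
-- X₅ becomes a single vertex.  Fix z₀ ∈ X₅ adjacent to X₃, and induced paths A in X₃ and B in
-- (X₄ ∪ X₅) − z₀ from N(X₂) to N(z₀).  If A and B touch they replace X₃ and X₄, z₀ having one
-- neighbour on each.  Otherwise join them by an induced path C in X₃ ∪ X₄ from N[A] to N[B]:
-- its first vertex joins A and the rest joins B, which works unless z₀ has an inner neighbour
-- on C.  In that case let b be the last one and β its successor.  If b has no neighbour in X₂,
-- then b replaces z₀, z₀ joins A and the part of C after b joins B (b now sees only z₀ and β);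
-- otherwise {b, β} replaces X₃ and the part of C after β joins B.

open import Defs
open import Data.Nat using (_≤_)
open import Data.Product using (Σ; _×_)
open import Data.Fin.Subset using (∣_∣; _∩_)
open import Relation.Binary.PropositionalEquality using (_≡_)

open import Level using (0ℓ)
open import Data.Bool as Bool using (Bool; true; false)
open import Data.Empty using (⊥-elim)
open import Data.Fin using (Fin; zero; suc; _<_)
import Data.Fin.Properties as Fin
open import Data.Fin.Subset using (Subset; ⁅_⁆; _∪_; _∈_; _∉_; _⊆_; Nonempty)
  renaming (⊥ to ∅)
import Data.Fin.Subset.Properties as Subset
open import Data.List using (List; []; _∷_; _++_; length; drop)
open import Data.List.Properties using (++-assoc; length-++)
open import Data.List.Membership.Propositional using (find; lose)
  renaming (_∈_ to _∈ₗ_; _∉_ to _∉ₗ_)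
open import Data.List.Membership.Propositional.Properties using (∈-++⁺ˡ; ∈-++⁺ʳ; ∈-++⁻)
open import Data.List.Relation.Binary.Subset.Propositional using () renaming (_⊆_ to _⊆ₗ_)
open import Data.List.Relation.Binary.Subset.Propositional.Properties
  using (⊆-trans; ∷⁺ʳ; xs⊆x∷xs; xs⊆ys++xs)
open import Data.List.Relation.Unary.All as All using (All; []; _∷_)
open import Data.List.Relation.Unary.All.Properties using (¬Any⇒All¬)
open import Data.List.Relation.Unary.Any as Any using (Any; here; there; any?)
open import Data.List.Relation.Unary.Any.Properties using ()
  renaming (++⁺ʳ to Any-++⁺ʳ; ++⁺ˡ to Any-++⁺ˡ)
open import Data.Nat using (ℕ; zero; suc; _+_; z≤n; s≤s)
import Data.Nat.Properties as ℕ
open import Data.Product using (_,_; proj₁; proj₂; ∃; ∃-syntax)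
open import Data.Sum using (_⊎_; inj₁; inj₂; [_,_]′)
open import Data.Unit using (⊤; tt)
open import Data.Vec using ([]; _∷_; lookup)
import Data.Vec.Properties as Vec
open import Function using (_∘_)
open import Function.Bundles using (_⇔_; mk⇔; Equivalence)
import Relation.Binary.PropositionalEquality as ≡
open ≡ using (refl; trans; cong; subst; subst₂; _≢_)
open import Relation.Binary.Definitions using (tri<; tri≈; tri>)
open import Relation.Nullary using (¬_; Dec; yes; no; ¬?; _×-dec_; _⊎-dec_)
open import Relation.Nullary.Decidable using (decidable-stable)
open import Relation.Unary using (Pred; Decidable; ∁)

module _ {A : Set} {P : Pred A 0ℓ} (P? : Decidable P) where

  split-first : ∀ {xs} → Any P xs →
                ∃[ ys ] ∃[ y ] ∃[ zs ] (xs ≡ ys ++ y ∷ zs × All (∁ P) ys × P y)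
  split-first {x ∷ xs} any with P? x
  ... | yes px = [] , x , xs , refl , [] , px
  ... | no ¬px with split-first (Any.tail ¬px any)
  ...   | ys , y , zs , refl , ¬ys , py = x ∷ ys , y , zs , refl , ¬px ∷ ¬ys , py

  split-last : ∀ {xs} → Any P xs →
               ∃[ ys ] ∃[ y ] ∃[ zs ] (xs ≡ ys ++ y ∷ zs × P y × All (∁ P) zs)
  split-last {x ∷ xs} any with any? P? xs
  ... | yes anyₓₛ with split-last anyₓₛ
  ...   | ys , y , zs , refl , py , ¬zs = x ∷ ys , y , zs , refl , py , ¬zs
  split-last {x ∷ xs} any | no ¬anyₓₛ =
    [] , x , xs , refl , Any.head ¬anyₓₛ any , ¬Any⇒All¬ xs ¬anyₓₛ

  at-most-two-or-between : ∀ xs →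
    (∃[ ws ] (length ws ≤ 2 × (∀ {y} → y ∈ₗ xs → P y → y ∈ₗ ws))) ⊎
    (∃[ ys ] ∃[ y ] ∃[ zs ] (xs ≡ ys ++ y ∷ zs × Any P ys × P y × Any P zs))
  at-most-two-or-between xs with any? P? xs
  ... | no none = inj₁ ([] , z≤n , λ y∈ py → ⊥-elim (none (lose y∈ py)))
  ... | yes any with split-first any
  ...   | ys , a , rs , refl , ¬ys , pa with any? P? rs
  ...     | no ¬rs = inj₁ (a ∷ [] , s≤s z≤n , only-a)
    where
    only-a : ∀ {y} → y ∈ₗ ys ++ a ∷ rs → P y → y ∈ₗ a ∷ []
    only-a y∈ py with ∈-++⁻ ys y∈
    ... | inj₁ y∈ys = ⊥-elim (All.lookup ¬ys y∈ys py)
    ... | inj₂ (here refl) = here refl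
    ... | inj₂ (there y∈rs) = ⊥-elim (¬rs (lose y∈rs py))
  ...     | yes anyᵣₛ with split-first anyᵣₛ
  ...       | qs , b , ts , refl , ¬qs , pb with any? P? ts
  ...         | yes anyₜₛ =
    inj₂ (ys ++ a ∷ qs , b , ts , ≡.sym (++-assoc ys (a ∷ qs) (b ∷ ts)) ,
          Any-++⁺ʳ ys (here pa) , pb , anyₜₛ)
  ...         | no ¬ts = inj₁ (a ∷ b ∷ [] , s≤s (s≤s z≤n) , only-a-b)
    where
    only-a-b : ∀ {y} → y ∈ₗ ys ++ a ∷ qs ++ b ∷ ts → P y → y ∈ₗ a ∷ b ∷ []
    only-a-b y∈ py with ∈-++⁻ ys y∈
    ... | inj₁ y∈ys = ⊥-elim (All.lookup ¬ys y∈ys py)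
    ... | inj₂ (here refl) = here refl
    ... | inj₂ (there y∈) with ∈-++⁻ qs y∈
    ...   | inj₁ y∈qs = ⊥-elim (All.lookup ¬qs y∈qs py)
    ...   | inj₂ (here refl) = there (here refl)
    ...   | inj₂ (there y∈ts) = ⊥-elim (¬ts (lose y∈ts py))

suffix-⊆ : ∀ {A : Set} pre {xs ys : List A} → xs ≡ pre ++ ys → ys ⊆ₗ xs
suffix-⊆ pre refl = xs⊆ys++xs _ pre

head∈prefix : ∀ {A : Set} pre {u y : A} {vs ys} → y ∈ₗ pre → u ∷ vs ≡ pre ++ ys → u ∈ₗ pre
head∈prefix (_ ∷ _) _ refl = here refl

∣p∪q∣≤∣p∣+∣q∣ : ∀ {m} (p q : Subset m) → ∣ p ∪ q ∣ ≤ ∣ p ∣ + ∣ q ∣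
∣p∪q∣≤∣p∣+∣q∣ [] [] = z≤n
∣p∪q∣≤∣p∣+∣q∣ (true ∷ p) (b ∷ q) =
  s≤s (ℕ.≤-trans (∣p∪q∣≤∣p∣+∣q∣ p q) (ℕ.+-monoʳ-≤ ∣ p ∣ (Subset.∣p∣≤∣x∷p∣ b q)))
∣p∪q∣≤∣p∣+∣q∣ (false ∷ p) (true ∷ q) rewrite ℕ.+-suc ∣ p ∣ ∣ q ∣ =
  s≤s (∣p∪q∣≤∣p∣+∣q∣ p q)
∣p∪q∣≤∣p∣+∣q∣ (false ∷ p) (false ∷ q) = ∣p∪q∣≤∣p∣+∣q∣ p q

anyFin-true : ∀ {k} (f : Fin k → Bool) → anyFin f ≡ true → ∃ λ i → f i ≡ true
anyFin-true {suc k} f any with f zero in eq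
... | true = zero , eq
... | false with anyFin-true (f ∘ suc) any
...   | i , eqᵢ = suc i , eqᵢ

-- Walks, induced paths and connectivity

module GraphProperties (G : Graph) where

  private
    V : Set
    V = Fin (n G)

  Adj-sym : ∀ {u v} → Adj G u v → Adj G v u
  Adj-sym {u} {v} = trans (sym G v u)

  Adj-irrefl : ∀ {u} → ¬ Adj G u u
  Adj-irrefl {u} uu with trans (≡.sym (irrefl G u)) uu
  ... | ()

  Adj? : ∀ u v → Dec (Adj G u v)
  Adj? u v = adj G u v Bool.≟ true

  HasNeighbourIn : Subset (n G) → Pred V 0ℓ
  HasNeighbourIn X v = ∃ λ u → u ∈ X × Adj G u v

  HasNeighbourIn? : ∀ X → Decidable (HasNeighbourIn X)
  HasNeighbourIn? X v = Fin.any? λ u → u Subset.∈? X ×-dec Adj? u v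

  N[_] : List V → Pred V 0ℓ
  N[ S ] y = y ∈ₗ S ⊎ Any (λ s → Adj G s y) S

  N[_]? : ∀ S → Decidable N[ S ]
  N[ S ]? y = any? (y Fin.≟_) S ⊎-dec any? (λ s → Adj? s y) S

  ∈N⁻ : ∀ {S v} → v ∈ N G S → HasNeighbourIn S v
  ∈N⁻ {S} {v} v∈N
    with anyFin-true _ (trans (≡.sym (Vec.lookup∘tabulate _ v)) (Vec.[]=⇒lookup v∈N))
  ... | u , eq with lookup S u in u∈S | adj G u v in uv
  ... | true | true = u , Vec.lookup⇒[]= u S u∈S , uv

  Touch-sym : ∀ {X Y} → Touch G X Y → Touch G Y X
  Touch-sym (u , v , u∈X , v∈Y , uv) = v , u , v∈Y , u∈X , Adj-sym uv

  touch-neighbour : ∀ {P Q} → Touch G P Q → ∃ λ u → u ∈ P × HasNeighbourIn Q u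
  touch-neighbour (u , v , u∈P , v∈Q , uv) = u , u∈P , v , v∈Q , Adj-sym uv

  ⟦_⟧ : List V → Subset (n G)
  ⟦ [] ⟧ = ∅
  ⟦ y ∷ ys ⟧ = ⁅ y ⁆ ∪ ⟦ ys ⟧

  ∈⟦⟧⁺ : ∀ {y ys} → y ∈ₗ ys → y ∈ ⟦ ys ⟧
  ∈⟦⟧⁺ (here refl) = Subset.x∈p∪q⁺ (inj₁ (Subset.x∈⁅x⁆ _))
  ∈⟦⟧⁺ (there y∈) = Subset.x∈p∪q⁺ (inj₂ (∈⟦⟧⁺ y∈))

  ∈⟦⟧⁻ : ∀ {y} ys → y ∈ ⟦ ys ⟧ → y ∈ₗ ys
  ∈⟦⟧⁻ [] y∈ = ⊥-elim (Subset.∉⊥ y∈)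
  ∈⟦⟧⁻ (w ∷ ws) y∈ with Subset.x∈p∪q⁻ ⁅ w ⁆ ⟦ ws ⟧ y∈
  ... | inj₁ y∈w = here (Subset.x∈⁅y⁆⇒x≡y w y∈w)
  ... | inj₂ y∈ws = there (∈⟦⟧⁻ ws y∈ws)

  ∣⟦⟧∣≤length : ∀ ys → ∣ ⟦ ys ⟧ ∣ ≤ length ys
  ∣⟦⟧∣≤length [] = ℕ.≤-reflexive (Subset.∣⊥∣≡0 (n G))
  ∣⟦⟧∣≤length (y ∷ ys) = begin
    ∣ ⁅ y ⁆ ∪ ⟦ ys ⟧ ∣       ≤⟨ ∣p∪q∣≤∣p∣+∣q∣ ⁅ y ⁆ ⟦ ys ⟧ ⟩
    ∣ ⁅ y ⁆ ∣ + ∣ ⟦ ys ⟧ ∣   ≡⟨ cong (_+ ∣ ⟦ ys ⟧ ∣) (Subset.∣⁅x⁆∣≡1 y) ⟩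
    suc ∣ ⟦ ys ⟧ ∣           ≤⟨ s≤s (∣⟦⟧∣≤length ys) ⟩
    suc (length ys)          ∎
    where open ℕ.≤-Reasoning

  AtMostNeighbours : ℕ → V → List V → Set
  AtMostNeighbours k x S =
    ∃[ ws ] (length ws ≤ k × (∀ {y} → y ∈ₗ S → Adj G x y → y ∈ₗ ws))

  ∣N⁅x⁆∩⟦S⟧∣≤ : ∀ {k x} S → AtMostNeighbours k x S → ∣ N G ⁅ x ⁆ ∩ ⟦ S ⟧ ∣ ≤ k
  ∣N⁅x⁆∩⟦S⟧∣≤ {k} {x} S (ws , ∣ws∣≤k , covers) =
    ℕ.≤-trans (Subset.p⊆q⇒∣p∣≤∣q∣ N⁅x⁆∩S⊆ws) (ℕ.≤-trans (∣⟦⟧∣≤length ws) ∣ws∣≤k)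
    where
    N⁅x⁆∩S⊆ws : N G ⁅ x ⁆ ∩ ⟦ S ⟧ ⊆ ⟦ ws ⟧
    N⁅x⁆∩S⊆ws y∈ with Subset.x∈p∩q⁻ (N G ⁅ x ⁆) ⟦ S ⟧ y∈
    ... | y∈N , y∈S with ∈N⁻ y∈N
    ...   | u , u∈⁅x⁆ , uy rewrite Subset.x∈⁅y⁆⇒x≡y x u∈⁅x⁆ =
      ∈⟦⟧⁺ (covers (∈⟦⟧⁻ S y∈S) uy)

  no-neighbours : ∀ {x S} → (∀ {y} → y ∈ₗ S → ¬ Adj G x y) → AtMostNeighbours 0 x S
  no-neighbours ¬adj = [] , z≤n , λ y∈ xy → ⊥-elim (¬adj y∈ xy)

  one-neighbour : ∀ {x S} w → (∀ {y} → y ∈ₗ S → Adj G x y → y ≡ w) →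
                  AtMostNeighbours 1 x S
  one-neighbour w only-w = w ∷ [] , s≤s z≤n , λ y∈ xy → here (only-w y∈ xy)

  AtMostNeighbours-∷ : ∀ {k x S} y → AtMostNeighbours k x S →
                       AtMostNeighbours (suc k) x (y ∷ S)
  AtMostNeighbours-∷ y (ws , ∣ws∣≤k , covers) = y ∷ ws , s≤s ∣ws∣≤k , λ
    { (here refl) _ → here refl
    ; (there y∈) xy → there (covers y∈ xy) }

  AtMostNeighbours-++ : ∀ {k l x S T} → AtMostNeighbours k x S → AtMostNeighbours l x T →
                        AtMostNeighbours (k + l) x (S ++ T)
  AtMostNeighbours-++ {S = S} (ws , ∣ws∣≤k , coversˢ) (vs , ∣vs∣≤l , coversᵀ) =
    ws ++ vs ,
    ℕ.≤-trans (ℕ.≤-reflexive (length-++ ws)) (ℕ.+-mono-≤ ∣ws∣≤k ∣vs∣≤l) ,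
    λ y∈ xy → [ (λ y∈S → ∈-++⁺ˡ (coversˢ y∈S xy)) , (λ y∈T → ∈-++⁺ʳ ws (coversᵀ y∈T xy)) ]′
                (∈-++⁻ S y∈)

  AtMostNeighbours-≤ : ∀ {k l x S} → k ≤ l → AtMostNeighbours k x S → AtMostNeighbours l x S
  AtMostNeighbours-≤ k≤l (ws , ∣ws∣≤k , covers) = ws , ℕ.≤-trans ∣ws∣≤k k≤l , covers

  Reach-source : ∀ {X u v} → Reach G X u v → u ∈ X
  Reach-source (here u∈X) = u∈X
  Reach-source (step u∈X _ _) = u∈X

  Reach-trans : ∀ {X u v w} → Reach G X u v → Reach G X v w → Reach G X u w
  Reach-trans (here _) r = r
  Reach-trans (step u∈X uw r) r′ = step u∈X uw (Reach-trans r r′)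

  Reach-sym : ∀ {X u v} → Reach G X u v → Reach G X v u
  Reach-sym (here u∈X) = here u∈X
  Reach-sym (step u∈X uw r) =
    Reach-trans (Reach-sym r) (step (Reach-source r) (Adj-sym uw) (here u∈X))

  Reach-mono : ∀ {X Y u v} → X ⊆ Y → Reach G X u v → Reach G Y u v
  Reach-mono X⊆Y (here u∈X) = here (X⊆Y u∈X)
  Reach-mono X⊆Y (step u∈X uw r) = step (X⊆Y u∈X) uw (Reach-mono X⊆Y r)

  Reach-∪ : ∀ {X Y u v w z} → Reach G X u v → Adj G v w → Reach G Y w z →
            Reach G (X ∪ Y) u z
  Reach-∪ {X} {Y} r vw r′ =
    Reach-trans (Reach-mono (Subset.p⊆p∪q Y) r)
                (step (Subset.p⊆p∪q Y (Reach-source (Reach-sym r))) vw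
                      (Reach-mono (Subset.q⊆p∪q X Y) r′))

  ⁅⁆-connected : ∀ x → Connected G ⁅ x ⁆
  ⁅⁆-connected x u v u∈ v∈ with Subset.x∈⁅y⁆⇒x≡y x u∈ | Subset.x∈⁅y⁆⇒x≡y x v∈
  ... | refl | refl = here u∈

  []-connected : Connected G ⟦ [] ⟧
  []-connected u v u∈ = ⊥-elim (Subset.∉⊥ u∈)

  [-]-connected : ∀ x → Connected G ⟦ x ∷ [] ⟧
  [-]-connected x u v u∈ v∈ with ∈⟦⟧⁻ (x ∷ []) u∈ | ∈⟦⟧⁻ (x ∷ []) v∈
  ... | here refl | here refl = here u∈

  ⟦⟧-++ˡ : ∀ S {T} → ⟦ S ⟧ ⊆ ⟦ S ++ T ⟧
  ⟦⟧-++ˡ S y∈ = ∈⟦⟧⁺ (∈-++⁺ˡ (∈⟦⟧⁻ S y∈))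

  ⟦⟧-++ʳ : ∀ S {T} → ⟦ T ⟧ ⊆ ⟦ S ++ T ⟧
  ⟦⟧-++ʳ S {T} y∈ = ∈⟦⟧⁺ (∈-++⁺ʳ S (∈⟦⟧⁻ T y∈))

  ++-connected : ∀ S T {s t} → Connected G ⟦ S ⟧ → Connected G ⟦ T ⟧ →
                 s ∈ₗ S → t ∈ₗ T → s ≡ t ⊎ Adj G s t → Connected G ⟦ S ++ T ⟧
  ++-connected S T {s} {t} S-conn T-conn s∈S t∈T s~t u v u∈ v∈ =
    reach (∈-++⁻ S (∈⟦⟧⁻ (S ++ T) u∈)) (∈-++⁻ S (∈⟦⟧⁻ (S ++ T) v∈))
    where
    withinS : ∀ {u v} → u ∈ₗ S → v ∈ₗ S → Reach G ⟦ S ++ T ⟧ u v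
    withinS u∈S v∈S = Reach-mono (⟦⟧-++ˡ S) (S-conn _ _ (∈⟦⟧⁺ u∈S) (∈⟦⟧⁺ v∈S))

    withinT : ∀ {u v} → u ∈ₗ T → v ∈ₗ T → Reach G ⟦ S ++ T ⟧ u v
    withinT u∈T v∈T = Reach-mono (⟦⟧-++ʳ S) (T-conn _ _ (∈⟦⟧⁺ u∈T) (∈⟦⟧⁺ v∈T))

    bridge : ∀ {v} → s ≡ t ⊎ Adj G s t → Reach G ⟦ S ++ T ⟧ t v → Reach G ⟦ S ++ T ⟧ s v
    bridge (inj₁ s≡t) r = subst (λ w → Reach G ⟦ S ++ T ⟧ w _) (≡.sym s≡t) r
    bridge (inj₂ st) r = step (∈⟦⟧⁺ (∈-++⁺ˡ s∈S)) st r

    across : ∀ {u v} → u ∈ₗ S → v ∈ₗ T → Reach G ⟦ S ++ T ⟧ u v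
    across u∈S v∈T = Reach-trans (withinS u∈S s∈S) (bridge s~t (withinT t∈T v∈T))

    reach : ∀ {u v} → u ∈ₗ S ⊎ u ∈ₗ T → v ∈ₗ S ⊎ v ∈ₗ T → Reach G ⟦ S ++ T ⟧ u v
    reach (inj₁ u∈S) (inj₁ v∈S) = withinS u∈S v∈S
    reach (inj₂ u∈T) (inj₂ v∈T) = withinT u∈T v∈T
    reach (inj₁ u∈S) (inj₂ v∈T) = across u∈S v∈T
    reach (inj₂ u∈T) (inj₁ v∈S) = Reach-sym (across v∈S u∈T)

  ∷-connected : ∀ {x} T → Any (Adj G x) T → Connected G ⟦ T ⟧ → Connected G ⟦ x ∷ T ⟧
  ∷-connected {x} T x-adj-T T-conn with find x-adj-T
  ... | t , t∈T , xt = ++-connected (x ∷ []) T ([-]-connected x) T-conn (here refl) t∈T (inj₂ xt)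

  -- Walk u vs v: u ∷ vs is the vertex sequence of a walk from u to v.
  data Walk : V → List V → V → Set where
    [] : ∀ {u} → Walk u [] u
    _∷_ : ∀ {u w vs v} → Adj G u w → Walk w vs v → Walk u (w ∷ vs) v

  fromReach : ∀ {X u v} → Reach G X u v → ∃[ vs ] (Walk u vs v × All (_∈ X) (u ∷ vs))
  fromReach (here u∈X) = [] , [] , u∈X ∷ []
  fromReach (step u∈X uw r) with fromReach r
  ... | vs , w , all∈X = _ , uw ∷ w , u∈X ∷ all∈X

  walk-end∈ : ∀ {u vs v} → Walk u vs v → v ∈ₗ u ∷ vs
  walk-end∈ [] = here refl
  walk-end∈ (_ ∷ w) = there (walk-end∈ w)

  walk-end∈-rest : ∀ {u vs v y} → Walk u vs v → y ∈ₗ vs → v ∈ₗ vs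
  walk-end∈-rest (_ ∷ w) _ = walk-end∈ w

  walk-second : ∀ {u vs v} → Walk u vs v → u ≢ v → ∃ λ y → y ∈ₗ vs × Adj G u y
  walk-second [] u≢v = ⊥-elim (u≢v refl)
  walk-second (uw ∷ _) _ = _ , here refl , uw

  walk-penultimate : ∀ {u vs v} → Walk u vs v → u ≢ v → ∃ λ y → y ∈ₗ u ∷ vs × Adj G y v
  walk-penultimate [] u≢v = ⊥-elim (u≢v refl)
  walk-penultimate (uw ∷ w) _ = penultimate uw w
    where
    penultimate : ∀ {u w vs v} → Adj G u w → Walk w vs v →
                  ∃ λ y → y ∈ₗ u ∷ w ∷ vs × Adj G y v
    penultimate uw [] = _ , here refl , uw
    penultimate _ (wx ∷ w) with penultimate wx w
    ... | y , y∈ , yv = y , there y∈ , yv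

  walk-suffix : ∀ pre {u vs v b post} → u ∷ vs ≡ pre ++ b ∷ post → Walk u vs v → Walk b post v
  walk-suffix [] refl w = w
  walk-suffix (_ ∷ []) refl (_ ∷ w) = w
  walk-suffix (_ ∷ p ∷ pre) refl (_ ∷ w) = walk-suffix (p ∷ pre) refl w

  walk-connected : ∀ {u vs v} → Walk u vs v → Connected G ⟦ u ∷ vs ⟧
  walk-connected {u} [] = [-]-connected u
  walk-connected {vs = vs} (uw ∷ w) = ∷-connected vs (here uw) (walk-connected w)

  walk-rest-connected : ∀ {u vs v} → Walk u vs v → Connected G ⟦ vs ⟧
  walk-rest-connected [] = []-connected
  walk-rest-connected (_ ∷ w) = walk-connected w

  walk-prefix-connected : ∀ pre {u vs v b post} → u ∷ vs ≡ pre ++ b ∷ post → Walk u vs v →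
                          Connected G ⟦ pre ⟧
  walk-prefix-connected [] _ _ = []-connected
  walk-prefix-connected (u ∷ []) refl _ = [-]-connected u
  walk-prefix-connected (_ ∷ p ∷ pre) refl (up ∷ w) =
    ∷-connected (p ∷ pre) (here up) (walk-prefix-connected (p ∷ pre) refl w)

  walk-rest-++-connected : ∀ {u vs v T} → Walk u vs v → Any (Adj G v) T → Connected G ⟦ T ⟧ →
                           Connected G ⟦ vs ++ T ⟧
  walk-rest-++-connected [] _ T-conn = T-conn
  walk-rest-++-connected {T = T} (_∷_ {vs = vs} _ w) v-adj-T T-conn with find v-adj-T
  ... | t , t∈T , vt =
    ++-connected (_ ∷ vs) T (walk-connected w) T-conn (walk-end∈ w) t∈T (inj₂ vt)

  walk-rest-++-touch : ∀ {u vs v T} → Walk u vs v → Any (Adj G v) T → Any (Adj G u) (vs ++ T)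
  walk-rest-++-touch [] u-adj-T = u-adj-T
  walk-rest-++-touch (uw ∷ _) _ = here uw

  -- No repetitions and no edges between list elements two or more steps apart: the vertex
  -- sequence of a walk with this property is an induced path.
  Chordless : List V → Set
  Chordless [] = ⊤
  Chordless (x ∷ xs) = (x ∉ₗ xs × All (λ y → ¬ Adj G x y) (drop 1 xs)) × Chordless xs

  chordless-suffix : ∀ pre {post} → Chordless (pre ++ post) → Chordless post
  chordless-suffix [] ch = ch
  chordless-suffix (_ ∷ pre) (_ , ch) = chordless-suffix pre ch

  chordless-∉-prefix : ∀ pre {b post} → Chordless (pre ++ b ∷ post) → b ∉ₗ pre
  chordless-∉-prefix (a ∷ pre) ((a∉ , _) , _) (here refl) = a∉ (∈-++⁺ʳ pre (here refl))
  chordless-∉-prefix (_ ∷ pre) (_ , ch) (there b∈) = chordless-∉-prefix pre ch b∈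

  chordless-∉-suffix : ∀ pre {b post} → Chordless (pre ++ b ∷ post) → b ∉ₗ post
  chordless-∉-suffix pre ch = proj₁ (proj₁ (chordless-suffix pre ch))

  chordless-successor : ∀ {b post} → Chordless (b ∷ post) → AtMostNeighbours 1 b post
  chordless-successor {post = []} _ = [] , z≤n , λ ()
  chordless-successor {post = c ∷ _} ((_ , far) , _) = one-neighbour c λ
    { (here refl) _ → refl
    ; (there y∈) by → ⊥-elim (All.lookup far y∈ by) }

  chordless-predecessor : ∀ pre {b post} → Chordless (pre ++ b ∷ post) →
                          AtMostNeighbours 1 b pre
  chordless-predecessor [] _ = [] , z≤n , λ ()
  chordless-predecessor (a ∷ []) _ = one-neighbour a λ { (here refl) _ → refl }
  chordless-predecessor (a ∷ a′ ∷ pre) ((_ , far) , ch)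
    with chordless-predecessor (a′ ∷ pre) ch
  ... | ws , ∣ws∣≤1 , covers = ws , ∣ws∣≤1 , λ
    { (here refl) ba → ⊥-elim (All.lookup far (∈-++⁺ʳ pre (here refl)) (Adj-sym ba))
    ; (there y∈) by → covers y∈ by }

  chordless-neighbours : ∀ pre {b post} → Chordless (pre ++ b ∷ post) →
                         AtMostNeighbours 2 b (pre ++ post)
  chordless-neighbours pre ch = AtMostNeighbours-++
    (chordless-predecessor pre ch) (chordless-successor (chordless-suffix pre ch))

  chordless-∷ : ∀ {u c post} → Adj G u c → All (∁ N[ u ∷ [] ]) post → Chordless (c ∷ post) →
                Chordless (u ∷ c ∷ post)
  chordless-∷ {u} {c} {post} uc far ch =
    (u∉ , All.map (λ ¬near uy → ¬near (inj₂ (here uy))) far) , ch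
    where
    u∉ : u ∉ₗ c ∷ post
    u∉ (here refl) = Adj-irrefl uc
    u∉ (there u∈post) = All.lookup far u∈post (inj₁ (here refl))

  -- Jump from u straight to the last vertex of the walk in N[u]; everything after it is then
  -- neither u nor adjacent to u.
  shortcut-∷ : ∀ {u w ws v} → Adj G u w → Walk w ws v → Chordless (w ∷ ws) →
               ∃[ xs ] (Walk u xs v × Chordless (u ∷ xs) × u ∷ xs ⊆ₗ u ∷ w ∷ ws)
  shortcut-∷ {u} {w} {ws} uw walk ch
    with split-last (N[ u ∷ [] ]?) {w ∷ ws} (here (inj₂ (here uw)))
  ... | pre , c , post , eq , inj₁ (here refl) , far =
    post , walk-suffix pre eq walk , chordless-suffix pre (subst Chordless eq ch) ,
    ∷⁺ʳ u (⊆-trans (xs⊆x∷xs post c) (suffix-⊆ pre eq))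
  ... | pre , c , post , eq , inj₂ (here uc) , far =
    c ∷ post , uc ∷ walk-suffix pre eq walk ,
    chordless-∷ uc far (chordless-suffix pre (subst Chordless eq ch)) , ∷⁺ʳ u (suffix-⊆ pre eq)

  shortcut : ∀ {u vs v} → Walk u vs v →
             ∃[ ws ] (Walk u ws v × Chordless (u ∷ ws) × u ∷ ws ⊆ₗ u ∷ vs)
  shortcut [] = [] , [] , (((λ ()) , []) , tt) , λ y∈ → y∈
  shortcut {u} (uw ∷ w) with shortcut w
  ... | ws , w′ , ch , ⊆vs with shortcut-∷ uw w′ ch
  ...   | xs , w″ , ch′ , ⊆ws = xs , w″ , ch′ , ⊆-trans ⊆ws (∷⁺ʳ u ⊆vs)

  walk-to-first : ∀ {B : Pred V 0ℓ} → Decidable B → ∀ {u vs v} → Walk u vs v → B v →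
    ∃[ rest ] ∃[ e ] (Walk u rest e × u ∷ rest ⊆ₗ u ∷ vs × B e ×
                      (∀ {y} → y ∈ₗ u ∷ rest → B y → y ≡ e))
  walk-to-first B? {u} w bv with B? u
  ... | yes bu = [] , u , [] , ∷⁺ʳ u (λ ()) , bu , λ { (here refl) _ → refl }
  walk-to-first B? [] bv | no ¬bu = ⊥-elim (¬bu bv)
  walk-to-first B? {u} (uw ∷ w) bv | no ¬bu with walk-to-first B? w bv
  ... | rest , e , w′ , ⊆vs , be , only-e =
    _ ∷ rest , e , uw ∷ w′ , ∷⁺ʳ u ⊆vs , be ,
    λ { (here refl) bu → ⊥-elim (¬bu bu) ; (there y∈) by → only-e y∈ by }

  walk-from-last : ∀ {A : Pred V 0ℓ} → Decidable A → ∀ {u vs v} → Walk u vs v → A u →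
    ∃[ a ] ∃[ rest ] (Walk a rest v × a ∷ rest ⊆ₗ u ∷ vs × A a ×
                      (∀ {y} → y ∈ₗ a ∷ rest → A y → y ≡ a))
  walk-from-last A? w au with split-last A? (here au)
  ... | pre , a , rest , eq , aa , ¬rest =
    a , rest , walk-suffix pre eq w , suffix-⊆ pre eq , aa ,
    λ { (here refl) _ → refl ; (there y∈) ay → ⊥-elim (All.lookup ¬rest y∈ ay) }

  record InducedPath (X : Subset (n G)) (A B : Pred V 0ℓ) : Set where
    field
      first last : V
      rest : List V
      walk : Walk first rest last
      chordless : Chordless (first ∷ rest)
      inside : ∀ {y} → y ∈ₗ first ∷ rest → y ∈ X
      first∈A : A first
      last∈B : B last
      A-only-at-first : ∀ {y} → y ∈ₗ first ∷ rest → A y → y ≡ first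
      B-only-at-last : ∀ {y} → y ∈ₗ first ∷ rest → B y → y ≡ last

    vertices : List V
    vertices = first ∷ rest

  induced-path : ∀ {X A B u v} → Decidable A → Decidable B →
                 Reach G X u v → A u → B v → InducedPath X A B
  induced-path A? B? r au bv with fromReach r
  ... | vs , w₀ , all∈X with walk-to-first B? w₀ bv
  ... | rest₁ , e , w₁ , ⊆₁ , be , only-e with walk-from-last A? w₁ au
  ... | a , rest₂ , w₂ , ⊆₂ , aa , only-a with shortcut w₂
  ... | rest , w , ch , ⊆₃ = record
    { first = a ; last = e ; rest = rest ; walk = w ; chordless = ch
    ; inside = λ y∈ → All.lookup all∈X (⊆₁ (⊆₂ (⊆₃ y∈)))
    ; first∈A = aa ; last∈B = be
    ; A-only-at-first = λ y∈ → only-a (⊆₃ y∈)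
    ; B-only-at-last = λ y∈ → only-e (⊆₂ (⊆₃ y∈)) }

  module _ {X : Subset (n G)} {A : Pred V 0ℓ} {S : List V} (p : InducedPath X A N[ S ]) where
    open InducedPath p

    last∉ : first ∉ₗ S → last ∉ₗ S
    last∉ first∉S last∈S with walk-penultimate walk (λ { refl → first∉S last∈S })
    ... | y , y∈ , y-last with B-only-at-last y∈ (inj₂ (lose last∈S (Adj-sym y-last)))
    ... | refl = Adj-irrefl y-last

  module _ {X : Subset (n G)} {B : Pred V 0ℓ} {S : List V} (p : InducedPath X N[ S ] B) where
    open InducedPath p

    first∉ : last ∉ₗ S → first ∉ₗ S
    first∉ last∉S first∈S with walk-second walk (λ { refl → last∉S first∈S })
    ... | y , y∈rest , first-y
        with A-only-at-first (there y∈rest) (inj₂ (lose first∈S first-y))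
    ... | refl = Adj-irrefl first-y

  ⁅⁆-touch : ∀ {x S} → Any (Adj G x) S → Touch G ⁅ x ⁆ ⟦ S ⟧
  ⁅⁆-touch {x} x-adj-S with find x-adj-S
  ... | y , y∈S , xy = x , y , Subset.x∈⁅x⁆ x , ∈⟦⟧⁺ y∈S , xy

  ⁅⁆-apart : ∀ {x Y} → ¬ HasNeighbourIn Y x → ¬ Touch G ⁅ x ⁆ Y
  ⁅⁆-apart {x} x-apart (u , v , u∈⁅x⁆ , v∈Y , uv) with Subset.x∈⁅y⁆⇒x≡y x u∈⁅x⁆
  ... | refl = x-apart (v , v∈Y , Adj-sym uv)

  ⟦⟧-touch : ∀ {S Y} → Any (HasNeighbourIn Y) S → Touch G ⟦ S ⟧ Y
  ⟦⟧-touch S-touches-Y with find S-touches-Y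
  ... | y , y∈S , u , u∈Y , uy = y , u , ∈⟦⟧⁺ y∈S , u∈Y , Adj-sym uy

  ⟦⟧-touch-⟦⟧ : ∀ {S T} → Any (λ u → Any (Adj G u) T) S → Touch G ⟦ S ⟧ ⟦ T ⟧
  ⟦⟧-touch-⟦⟧ S-touches-T with find S-touches-T
  ... | u , u∈S , u-adj-T with find u-adj-T
  ...   | v , v∈T , uv = u , v , ∈⟦⟧⁺ u∈S , ∈⟦⟧⁺ v∈T , uv

  edge : ∀ {P Q} → Touch G P Q → Touch G P Q ⇔ (true ≡ true)
  edge touch = mk⇔ (λ _ → refl) (λ _ → touch)

  non-edge : ∀ {P Q} → ¬ Touch G P Q → Touch G P Q ⇔ (false ≡ true)
  non-edge apart = mk⇔ (⊥-elim ∘ apart) (λ ())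

-- Models of 𝕂

model-from-< : ∀ {H G} (Y : Fin (n H) → Subset (n G)) →
  (∀ y → Nonempty (Y y)) → (∀ y → Connected G (Y y)) →
  (∀ {y z} → y < z → Disjoint G (Y y) (Y z)) →
  (∀ {y z} → y < z → Touch G (Y y) (Y z) ⇔ Adj H y z) → Model H G
model-from-< {H} {G} Y Y-nonempty Y-connected Y-disjoint< Y-edges< = record
  { X = Y ; nonempty = Y-nonempty ; connected = Y-connected
  ; disjoint = Y-disjoint ; edges = Y-edges }
  where
  open GraphProperties using (Adj-sym; Touch-sym)

  Y-disjoint : ∀ y z → y ≢ z → Disjoint G (Y y) (Y z)
  Y-disjoint y z y≢z with Fin.<-cmp y z
  ... | tri< y<z _ _ = Y-disjoint< y<z
  ... | tri≈ _ y≡z _ = ⊥-elim (y≢z y≡z)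
  ... | tri> _ _ z<y = λ v v∈Y v∈Z → Y-disjoint< z<y v v∈Z v∈Y

  Y-edges : ∀ y z → y ≢ z → Touch G (Y y) (Y z) ⇔ Adj H y z
  Y-edges y z y≢z with Fin.<-cmp y z
  ... | tri< y<z _ _ = Y-edges< y<z
  ... | tri≈ _ y≡z _ = ⊥-elim (y≢z y≡z)
  ... | tri> _ _ z<y = mk⇔ (Adj-sym H ∘ Equivalence.to (Y-edges< z<y) ∘ Touch-sym G)
                           (Touch-sym G ∘ Equivalence.from (Y-edges< z<y) ∘ Adj-sym H)

module _ {G : Graph} (M : Model 𝕂 G) where

  open GraphProperties G

  private
    V : Set
    V = Fin (n G)

    X₁ X₂ X₃ X₄ X₅ : Subset (n G)
    X₁ = X M k1
    X₂ = X M k2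
    X₃ = X M k3
    X₄ = X M k4
    X₅ = X M k5

  branches-touch : ∀ y z → y ≢ z → Adj 𝕂 y z → Touch G (X M y) (X M z)
  branches-touch y z y≢z = Equivalence.from (edges M y z y≢z)

  branches-apart : ∀ y z → y ≢ z → ¬ Adj 𝕂 y z →
                   ∀ {u v} → u ∈ X M y → v ∈ X M z → ¬ Adj G u v
  branches-apart y z y≢z ¬yz u∈ v∈ uv =
    ¬yz (Equivalence.to (edges M y z y≢z) (_ , _ , u∈ , v∈ , uv))

  Left : Pred V 0ℓ
  Left v = v ∈ X₁ ⊎ v ∈ X₂

  Right : Pred V 0ℓ
  Right v = v ∈ X₃ ⊎ v ∈ X₄ ⊎ v ∈ X₅

  Right-branch : ∀ k {v} → v ∈ X M (suc (suc k)) → Right v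
  Right-branch zero v∈ = inj₁ v∈
  Right-branch (suc zero) v∈ = inj₂ (inj₁ v∈)
  Right-branch (suc (suc zero)) v∈ = inj₂ (inj₂ v∈)

  Left∩Right≡∅ : ∀ {v} → Left v → ¬ Right v
  Left∩Right≡∅ (inj₁ v∈X₁) (inj₁ v∈X₃) = disjoint M k1 k3 (λ ()) _ v∈X₁ v∈X₃
  Left∩Right≡∅ (inj₁ v∈X₁) (inj₂ (inj₁ v∈X₄)) = disjoint M k1 k4 (λ ()) _ v∈X₁ v∈X₄
  Left∩Right≡∅ (inj₁ v∈X₁) (inj₂ (inj₂ v∈X₅)) = disjoint M k1 k5 (λ ()) _ v∈X₁ v∈X₅
  Left∩Right≡∅ (inj₂ v∈X₂) (inj₁ v∈X₃) = disjoint M k2 k3 (λ ()) _ v∈X₂ v∈X₃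
  Left∩Right≡∅ (inj₂ v∈X₂) (inj₂ (inj₁ v∈X₄)) = disjoint M k2 k4 (λ ()) _ v∈X₂ v∈X₄
  Left∩Right≡∅ (inj₂ v∈X₂) (inj₂ (inj₂ v∈X₅)) = disjoint M k2 k5 (λ ()) _ v∈X₂ v∈X₅

  X₁-Right-apart : ∀ {u v} → u ∈ X₁ → Right v → ¬ Adj G u v
  X₁-Right-apart u∈ (inj₁ v∈X₃) = branches-apart k1 k3 (λ ()) (λ ()) u∈ v∈X₃
  X₁-Right-apart u∈ (inj₂ (inj₁ v∈X₄)) = branches-apart k1 k4 (λ ()) (λ ()) u∈ v∈X₄
  X₁-Right-apart u∈ (inj₂ (inj₂ v∈X₅)) = branches-apart k1 k5 (λ ()) (λ ()) u∈ v∈X₅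

  Left-X₅-apart : ∀ {u v} → Left u → v ∈ X₅ → ¬ Adj G u v
  Left-X₅-apart (inj₁ u∈X₁) v∈ = branches-apart k1 k5 (λ ()) (λ ()) u∈X₁ v∈
  Left-X₅-apart (inj₂ u∈X₂) v∈ = branches-apart k2 k5 (λ ()) (λ ()) u∈X₂ v∈

  X₁∩X₂≡∅ : ∀ {x} → x ∈ X₁ → x ∉ X₂
  X₁∩X₂≡∅ x∈X₁ x∈X₂ = disjoint M k1 k2 (λ ()) _ x∈X₁ x∈X₂

  X₁-apart-X₃ : ∀ {x} → x ∈ X₁ → ¬ HasNeighbourIn X₃ x
  X₁-apart-X₃ x∈X₁ (u , u∈X₃ , ux) = X₁-Right-apart x∈X₁ (inj₁ u∈X₃) (Adj-sym ux)

  X₁-apart-X₄ : ∀ {x} → x ∈ X₁ → ¬ HasNeighbourIn X₄ x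
  X₁-apart-X₄ x∈X₁ (u , u∈X₄ , ux) = X₁-Right-apart x∈X₁ (inj₂ (inj₁ u∈X₄)) (Adj-sym ux)

  X₂-apart-X₅ : ∀ {z} → z ∈ X₅ → ¬ HasNeighbourIn X₂ z
  X₂-apart-X₅ z∈X₅ (u , u∈X₂ , uz) = Left-X₅-apart (inj₂ u∈X₂) z∈X₅ uz

  -- New branch sets {x} and S for the vertices 1 and 2 of 𝕂; X₃, X₄ and X₅ are kept.
  record Rebranching₁₂ : Set where
    field
      x : V
      S : List V
      x-left : Left x
      S-left : ∀ {y} → y ∈ₗ S → Left y
      x∉S : x ∉ₗ S
      S-connected : Connected G ⟦ S ⟧
      x-adj-S : Any (Adj G x) S
      S-touches-X₃ : Any (HasNeighbourIn X₃) S
      S-touches-X₄ : Any (HasNeighbourIn X₄) S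
      x-apart-X₃ : ¬ HasNeighbourIn X₃ x
      x-apart-X₄ : ¬ HasNeighbourIn X₄ x
      x-degree : AtMostNeighbours 3 x S

  rebranch₁₂ : Rebranching₁₂ →
    Σ (Model 𝕂 G) λ M′ → ∣ X M′ k1 ∣ ≡ 1 × ∣ N G (X M′ k1) ∩ X M′ k2 ∣ ≤ 3
  rebranch₁₂ r = M′ , Subset.∣⁅x⁆∣≡1 x , ∣N⁅x⁆∩⟦S⟧∣≤ S x-degree
    where
    open Rebranching₁₂ r

    Y : Fin 5 → Subset (n G)
    Y zero = ⁅ x ⁆
    Y (suc zero) = ⟦ S ⟧
    Y k@(suc (suc _)) = X M k

    Y-nonempty : ∀ k → Nonempty (Y k)
    Y-nonempty zero = x , Subset.x∈⁅x⁆ x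
    Y-nonempty (suc zero) with find x-adj-S
    ... | y , y∈S , _ = y , ∈⟦⟧⁺ y∈S
    Y-nonempty k@(suc (suc _)) = nonempty M k

    Y-connected : ∀ k → Connected G (Y k)
    Y-connected zero = ⁅⁆-connected x
    Y-connected (suc zero) = S-connected
    Y-connected k@(suc (suc _)) = connected M k

    x-only : ∀ {v} → v ∈ ⁅ x ⁆ → v ≡ x
    x-only = Subset.x∈⁅y⁆⇒x≡y x

    Y-disjoint< : ∀ {j k} → j < k → Disjoint G (Y j) (Y k)
    Y-disjoint< {zero} {suc zero} _ v v∈x v∈S rewrite x-only v∈x = x∉S (∈⟦⟧⁻ S v∈S)
    Y-disjoint< {zero} {suc (suc k)} _ v v∈x v∈Y rewrite x-only v∈x =
      Left∩Right≡∅ x-left (Right-branch k v∈Y)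
    Y-disjoint< {suc zero} {suc (suc k)} _ v v∈S v∈Y =
      Left∩Right≡∅ (S-left (∈⟦⟧⁻ S v∈S)) (Right-branch k v∈Y)
    Y-disjoint< {suc (suc _)} {suc (suc _)} j<k = disjoint M _ _ (Fin.<⇒≢ j<k)
    Y-disjoint< {_} {zero} ()
    Y-disjoint< {suc _} {suc zero} (s≤s ())

    Y-edges< : ∀ {j k} → j < k → Touch G (Y j) (Y k) ⇔ Adj 𝕂 j k
    Y-edges< {zero} {suc zero} _ = edge (⁅⁆-touch x-adj-S)
    Y-edges< {zero} {suc (suc zero)} _ = non-edge (⁅⁆-apart x-apart-X₃)
    Y-edges< {zero} {suc (suc (suc zero))} _ = non-edge (⁅⁆-apart x-apart-X₄)
    Y-edges< {zero} {suc (suc (suc (suc zero)))} _ =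
      non-edge (⁅⁆-apart λ (u , u∈X₅ , ux) → Left-X₅-apart x-left u∈X₅ (Adj-sym ux))
    Y-edges< {suc zero} {suc (suc zero)} _ = edge (⟦⟧-touch S-touches-X₃)
    Y-edges< {suc zero} {suc (suc (suc zero))} _ = edge (⟦⟧-touch S-touches-X₄)
    Y-edges< {suc zero} {suc (suc (suc (suc zero)))} _ =
      non-edge λ (u , v , u∈S , v∈X₅ , uv) → Left-X₅-apart (S-left (∈⟦⟧⁻ S u∈S)) v∈X₅ uv
    Y-edges< {suc (suc _)} {suc (suc _)} j<k = edges M _ _ (Fin.<⇒≢ j<k)
    Y-edges< {_} {zero} ()
    Y-edges< {suc _} {suc zero} (s≤s ())

    M′ : Model 𝕂 G
    M′ = model-from-< Y Y-nonempty Y-connected Y-disjoint< Y-edges<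

  -- New branch sets P, Q and {z} for the vertices 3, 4 and 5 of 𝕂; X₁ and X₂ are kept.
  record Rebranching₃₄₅ : Set where
    field
      z : V
      P Q : List V
      z-right : Right z
      P-right : ∀ {y} → y ∈ₗ P → Right y
      Q-right : ∀ {y} → y ∈ₗ Q → Right y
      P∩Q≡∅ : ∀ {y} → y ∈ₗ P → y ∉ₗ Q
      z∉P : z ∉ₗ P
      z∉Q : z ∉ₗ Q
      P-connected : Connected G ⟦ P ⟧
      Q-connected : Connected G ⟦ Q ⟧
      P-touches-X₂ : Any (HasNeighbourIn X₂) P
      Q-touches-X₂ : Any (HasNeighbourIn X₂) Q
      P-touches-Q : Any (λ u → Any (Adj G u) Q) P
      z-adj-P : Any (Adj G z) P
      z-adj-Q : Any (Adj G z) Q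
      z-apart-X₂ : ¬ HasNeighbourIn X₂ z
      z-degree-P : AtMostNeighbours 2 z P
      z-degree-Q : AtMostNeighbours 2 z Q

  rebranch₃₄₅ : Rebranching₃₄₅ →
    Σ (Model 𝕂 G) λ M′ → X M′ k1 ≡ X₁ × X M′ k2 ≡ X₂ × ∣ X M′ k5 ∣ ≡ 1 ×
      ∣ N G (X M′ k5) ∩ X M′ k3 ∣ ≤ 2 × ∣ N G (X M′ k5) ∩ X M′ k4 ∣ ≤ 2
  rebranch₃₄₅ r =
    M′ , refl , refl , Subset.∣⁅x⁆∣≡1 z ,
    ∣N⁅x⁆∩⟦S⟧∣≤ P z-degree-P , ∣N⁅x⁆∩⟦S⟧∣≤ Q z-degree-Q
    where
    open Rebranching₃₄₅ r

    Y : Fin 5 → Subset (n G)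
    Y zero = X₁
    Y (suc zero) = X₂
    Y (suc (suc zero)) = ⟦ P ⟧
    Y (suc (suc (suc zero))) = ⟦ Q ⟧
    Y (suc (suc (suc (suc zero)))) = ⁅ z ⁆

    nonempty-⟦⟧ : ∀ {T} → Any (Adj G z) T → Nonempty ⟦ T ⟧
    nonempty-⟦⟧ z-adj-T with find z-adj-T
    ... | y , y∈T , _ = y , ∈⟦⟧⁺ y∈T

    Y-nonempty : ∀ k → Nonempty (Y k)
    Y-nonempty zero = nonempty M k1
    Y-nonempty (suc zero) = nonempty M k2
    Y-nonempty (suc (suc zero)) = nonempty-⟦⟧ z-adj-P
    Y-nonempty (suc (suc (suc zero))) = nonempty-⟦⟧ z-adj-Q
    Y-nonempty (suc (suc (suc (suc zero)))) = z , Subset.x∈⁅x⁆ z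

    Y-connected : ∀ k → Connected G (Y k)
    Y-connected zero = connected M k1
    Y-connected (suc zero) = connected M k2
    Y-connected (suc (suc zero)) = P-connected
    Y-connected (suc (suc (suc zero))) = Q-connected
    Y-connected (suc (suc (suc (suc zero)))) = ⁅⁆-connected z

    ⟦P⟧-right : ∀ {v} → v ∈ ⟦ P ⟧ → Right v
    ⟦P⟧-right = P-right ∘ ∈⟦⟧⁻ P

    ⟦Q⟧-right : ∀ {v} → v ∈ ⟦ Q ⟧ → Right v
    ⟦Q⟧-right = Q-right ∘ ∈⟦⟧⁻ Q

    ⁅z⁆-right : ∀ {v} → v ∈ ⁅ z ⁆ → Right v
    ⁅z⁆-right v∈ rewrite Subset.x∈⁅y⁆⇒x≡y z v∈ = z-right

    left-disjoint : ∀ {L T} → (∀ {v} → v ∈ L → Left v) → (∀ {v} → v ∈ T → Right v) →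
                    Disjoint G L T
    left-disjoint L-left T-right v v∈L v∈T = Left∩Right≡∅ (L-left v∈L) (T-right v∈T)

    z∉⟦⟧ : ∀ {T} → z ∉ₗ T → Disjoint G ⟦ T ⟧ ⁅ z ⁆
    z∉⟦⟧ {T} z∉T v v∈T v∈z rewrite Subset.x∈⁅y⁆⇒x≡y z v∈z = z∉T (∈⟦⟧⁻ T v∈T)

    Y-disjoint< : ∀ {j k} → j < k → Disjoint G (Y j) (Y k)
    Y-disjoint< {zero} {suc zero} _ = disjoint M k1 k2 (λ ())
    Y-disjoint< {zero} {suc (suc zero)} _ = left-disjoint inj₁ ⟦P⟧-right
    Y-disjoint< {zero} {suc (suc (suc zero))} _ = left-disjoint inj₁ ⟦Q⟧-right
    Y-disjoint< {zero} {suc (suc (suc (suc zero)))} _ = left-disjoint inj₁ ⁅z⁆-right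
    Y-disjoint< {suc zero} {suc (suc zero)} _ = left-disjoint inj₂ ⟦P⟧-right
    Y-disjoint< {suc zero} {suc (suc (suc zero))} _ = left-disjoint inj₂ ⟦Q⟧-right
    Y-disjoint< {suc zero} {suc (suc (suc (suc zero)))} _ = left-disjoint inj₂ ⁅z⁆-right
    Y-disjoint< {suc (suc zero)} {suc (suc (suc zero))} _ v v∈P v∈Q =
      P∩Q≡∅ (∈⟦⟧⁻ P v∈P) (∈⟦⟧⁻ Q v∈Q)
    Y-disjoint< {suc (suc zero)} {suc (suc (suc (suc zero)))} _ = z∉⟦⟧ z∉P
    Y-disjoint< {suc (suc (suc zero))} {suc (suc (suc (suc zero)))} _ = z∉⟦⟧ z∉Q
    Y-disjoint< {_} {zero} ()
    Y-disjoint< {suc _} {suc zero} (s≤s ())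
    Y-disjoint< {suc (suc _)} {suc (suc zero)} (s≤s (s≤s ()))
    Y-disjoint< {suc (suc (suc _))} {suc (suc (suc zero))} (s≤s (s≤s (s≤s ())))
    Y-disjoint< {suc (suc (suc (suc _)))} {suc (suc (suc (suc zero)))}
      (s≤s (s≤s (s≤s (s≤s ()))))

    X₁-apart : ∀ {T} → (∀ {v} → v ∈ T → Right v) → ¬ Touch G X₁ T
    X₁-apart T-right (u , v , u∈X₁ , v∈T , uv) = X₁-Right-apart u∈X₁ (T-right v∈T) uv

    Y-edges< : ∀ {j k} → j < k → Touch G (Y j) (Y k) ⇔ Adj 𝕂 j k
    Y-edges< {zero} {suc zero} _ = edge (branches-touch k1 k2 (λ ()) refl)
    Y-edges< {zero} {suc (suc zero)} _ = non-edge (X₁-apart ⟦P⟧-right)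
    Y-edges< {zero} {suc (suc (suc zero))} _ = non-edge (X₁-apart ⟦Q⟧-right)
    Y-edges< {zero} {suc (suc (suc (suc zero)))} _ = non-edge (X₁-apart ⁅z⁆-right)
    Y-edges< {suc zero} {suc (suc zero)} _ = edge (Touch-sym (⟦⟧-touch P-touches-X₂))
    Y-edges< {suc zero} {suc (suc (suc zero))} _ = edge (Touch-sym (⟦⟧-touch Q-touches-X₂))
    Y-edges< {suc zero} {suc (suc (suc (suc zero)))} _ =
      non-edge (⁅⁆-apart z-apart-X₂ ∘ Touch-sym)
    Y-edges< {suc (suc zero)} {suc (suc (suc zero))} _ = edge (⟦⟧-touch-⟦⟧ P-touches-Q)
    Y-edges< {suc (suc zero)} {suc (suc (suc (suc zero)))} _ =
      edge (Touch-sym (⁅⁆-touch z-adj-P))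
    Y-edges< {suc (suc (suc zero))} {suc (suc (suc (suc zero)))} _ =
      edge (Touch-sym (⁅⁆-touch z-adj-Q))
    Y-edges< {_} {zero} ()
    Y-edges< {suc _} {suc zero} (s≤s ())
    Y-edges< {suc (suc _)} {suc (suc zero)} (s≤s (s≤s ()))
    Y-edges< {suc (suc (suc _))} {suc (suc (suc zero))} (s≤s (s≤s (s≤s ())))
    Y-edges< {suc (suc (suc (suc _)))} {suc (suc (suc (suc zero)))}
      (s≤s (s≤s (s≤s (s≤s ()))))

    M′ : Model 𝕂 G
    M′ = model-from-< Y Y-nonempty Y-connected Y-disjoint< Y-edges<

  -- A single vertex for X₁

  module _ (D : InducedPath X₂ (HasNeighbourIn X₃) (HasNeighbourIn X₄)) where
    open InducedPath D

    D-left : ∀ {y} → y ∈ₗ vertices → Left y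
    D-left = inj₂ ∘ inside

    extend-by-path-to-X₁ : ¬ Any (HasNeighbourIn X₁) vertices → Rebranching₁₂
    extend-by-path-to-X₁ D-apart-X₁ with touch-neighbour (branches-touch k2 k1 (λ ()) refl)
    ... | t , t∈X₂ , t-adj-X₁ = record
      { x = x
      ; S = vertices ++ E.vertices
      ; x-left = inj₁ x∈X₁
      ; S-left = [ D-left , inj₂ ∘ E.inside ]′ ∘ ∈-++⁻ vertices
      ; x∉S = X₁∩X₂≡∅ x∈X₁ ∘ [ inside , E.inside ]′ ∘ ∈-++⁻ vertices
      ; S-connected = ++-connected vertices E.vertices (walk-connected walk)
                        (walk-connected E.walk) E.first∈A (here refl) (inj₁ refl)
      ; x-adj-S = Any-++⁺ʳ vertices (lose (walk-end∈ E.walk) xe)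
      ; S-touches-X₃ = here first∈A
      ; S-touches-X₄ = Any-++⁺ˡ (lose (walk-end∈ walk) last∈B)
      ; x-apart-X₃ = X₁-apart-X₃ x∈X₁
      ; x-apart-X₄ = X₁-apart-X₄ x∈X₁
      ; x-degree = AtMostNeighbours-≤ (s≤s z≤n) (AtMostNeighbours-++
          (no-neighbours λ y∈ xy → D-apart-X₁ (lose y∈ (x , x∈X₁ , xy)))
          (one-neighbour E.last λ y∈ xy → E.B-only-at-last y∈ (x , x∈X₁ , xy)))
      }
      where
      E : InducedPath X₂ (_∈ₗ vertices) (HasNeighbourIn X₁)
      E = induced-path (λ y → any? (y Fin.≟_) vertices) (HasNeighbourIn? X₁)
                       (connected M k2 first t (inside (here refl)) t∈X₂) (here refl) t-adj-X₁
      module E = InducedPath E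

      x : V
      x = proj₁ E.last∈B

      x∈X₁ : x ∈ X₁
      x∈X₁ = proj₁ (proj₂ E.last∈B)

      xe : Adj G x E.last
      xe = proj₂ (proj₂ E.last∈B)

    few-neighbours-on-D : ∀ {x} → x ∈ X₁ → Any (Adj G x) vertices →
                          AtMostNeighbours 2 x vertices → Rebranching₁₂
    few-neighbours-on-D {x} x∈X₁ x-adj-D x-degree = record
      { x = x
      ; S = vertices
      ; x-left = inj₁ x∈X₁
      ; S-left = D-left
      ; x∉S = X₁∩X₂≡∅ x∈X₁ ∘ inside
      ; S-connected = walk-connected walk
      ; x-adj-S = x-adj-D
      ; S-touches-X₃ = here first∈A
      ; S-touches-X₄ = lose (walk-end∈ walk) last∈B
      ; x-apart-X₃ = X₁-apart-X₃ x∈X₁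
      ; x-apart-X₄ = X₁-apart-X₄ x∈X₁
      ; x-degree = AtMostNeighbours-≤ (ℕ.n≤1+n 2) x-degree
      }

    swap-middle-neighbour : ∀ {x pre b post} → x ∈ X₁ → vertices ≡ pre ++ b ∷ post →
      Any (Adj G x) pre → Adj G x b → Any (Adj G x) post → Rebranching₁₂
    swap-middle-neighbour {x} {pre} {b} {post} x∈X₁ eq x-adj-pre xb x-adj-post
      with find x-adj-pre | find x-adj-post
    ... | a , a∈pre , _ | c , c∈post , xc = record
      { x = b
      ; S = x ∷ pre ++ post
      ; x-left = D-left b∈D
      ; S-left = λ { (here refl) → inj₁ x∈X₁ ; (there y∈) → D-left (pre++post⊆D y∈) }
      ; x∉S = λ { (here refl) → X₁∩X₂≡∅ x∈X₁ (inside b∈D)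
                ; (there b∈) → [ chordless-∉-prefix pre ch , chordless-∉-suffix pre ch ]′
                                 (∈-++⁻ pre b∈) }
      ; S-connected = ++-connected (x ∷ pre) post
          (∷-connected pre x-adj-pre (walk-prefix-connected pre eq walk))
          (walk-rest-connected suffix) (here refl) c∈post (inj₂ xc)
      ; x-adj-S = here (Adj-sym xb)
      ; S-touches-X₃ = there (Any-++⁺ˡ (lose first∈pre first∈A))
      ; S-touches-X₄ = there (Any-++⁺ʳ pre (lose last∈post last∈B))
      ; x-apart-X₃ = λ b-adj-X₃ → chordless-∉-prefix pre ch
          (subst (_∈ₗ pre) (≡.sym (A-only-at-first b∈D b-adj-X₃)) first∈pre)
      ; x-apart-X₄ = λ b-adj-X₄ → chordless-∉-suffix pre ch
          (subst (_∈ₗ post) (≡.sym (B-only-at-last b∈D b-adj-X₄)) last∈post)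
      ; x-degree = AtMostNeighbours-∷ x (chordless-neighbours pre ch)
      }
      where
      ch : Chordless (pre ++ b ∷ post)
      ch = subst Chordless eq chordless

      ⊆D : pre ++ b ∷ post ⊆ₗ vertices
      ⊆D = subst (_ ∈ₗ_) (≡.sym eq)

      b∈D : b ∈ₗ vertices
      b∈D = ⊆D (∈-++⁺ʳ pre (here refl))

      pre++post⊆D : pre ++ post ⊆ₗ vertices
      pre++post⊆D = [ ⊆D ∘ ∈-++⁺ˡ , ⊆D ∘ ∈-++⁺ʳ pre ∘ there ]′ ∘ ∈-++⁻ pre

      suffix : Walk b post last
      suffix = walk-suffix pre eq walk

      first∈pre : first ∈ₗ pre
      first∈pre = head∈prefix pre a∈pre eq

      last∈post : last ∈ₗ post
      last∈post = walk-end∈-rest suffix c∈post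

    rebranching₁₂ : Rebranching₁₂
    rebranching₁₂ with any? (HasNeighbourIn? X₁) vertices
    ... | no D-apart-X₁ = extend-by-path-to-X₁ D-apart-X₁
    ... | yes D-touches-X₁ with find D-touches-X₁
    ...   | y , y∈D , x , x∈X₁ , xy with at-most-two-or-between (Adj? x) vertices
    ...     | inj₁ x-degree = few-neighbours-on-D x∈X₁ (lose y∈D xy) x-degree
    ...     | inj₂ (pre , b , post , eq , x-adj-pre , xb , x-adj-post) =
      swap-middle-neighbour x∈X₁ eq x-adj-pre xb x-adj-post

  shrink-branch₁ : Σ (Model 𝕂 G) λ M′ → ∣ X M′ k1 ∣ ≡ 1 × ∣ N G (X M′ k1) ∩ X M′ k2 ∣ ≤ 3
  shrink-branch₁
    with touch-neighbour (branches-touch k2 k3 (λ ()) refl)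
       | touch-neighbour (branches-touch k2 k4 (λ ()) refl)
  ... | s , s∈X₂ , s-adj-X₃ | t , t∈X₂ , t-adj-X₄ =
    rebranch₁₂ (rebranching₁₂ (induced-path (HasNeighbourIn? X₃) (HasNeighbourIn? X₄)
                                            (connected M k2 s t s∈X₂ t∈X₂) s-adj-X₃ t-adj-X₄))

  -- A single vertex for X₅

  -- B ends in N[z₀] rather than N(z₀) so that it can be cut out of a walk ending at z₀.
  module _ {z₀ : V} (z₀∈X₅ : z₀ ∈ X₅)
           (A : InducedPath X₃ (HasNeighbourIn X₂) (Adj G z₀))
           (B : InducedPath (X₄ ∪ X₅) (HasNeighbourIn X₂) N[ z₀ ∷ [] ]) where
    private
      module A = InducedPath A
      module B = InducedPath B

    z₀-right : Right z₀
    z₀-right = inj₂ (inj₂ z₀∈X₅)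

    A-right : ∀ {y} → y ∈ₗ A.vertices → Right y
    A-right = inj₁ ∘ A.inside

    B-right : ∀ {y} → y ∈ₗ B.vertices → Right y
    B-right = inj₂ ∘ Subset.x∈p∪q⁻ X₄ X₅ ∘ B.inside

    A∩B≡∅ : ∀ {y} → y ∈ₗ A.vertices → y ∉ₗ B.vertices
    A∩B≡∅ y∈A y∈B with Subset.x∈p∪q⁻ X₄ X₅ (B.inside y∈B)
    ... | inj₁ y∈X₄ = disjoint M k3 k4 (λ ()) _ (A.inside y∈A) y∈X₄
    ... | inj₂ y∈X₅ = disjoint M k3 k5 (λ ()) _ (A.inside y∈A) y∈X₅

    z₀∉A : z₀ ∉ₗ A.vertices
    z₀∉A z₀∈A = disjoint M k3 k5 (λ ()) _ (A.inside z₀∈A) z₀∈X₅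

    B-last≢z₀ : B.last ∉ₗ z₀ ∷ []
    B-last≢z₀ = last∉ B λ { (here refl) → X₂-apart-X₅ z₀∈X₅ B.first∈A }

    z₀∉B : z₀ ∉ₗ B.vertices
    z₀∉B z₀∈B with B.B-only-at-last z₀∈B (inj₁ (here refl))
    ... | refl = B-last≢z₀ (here refl)

    z₀-adj-B-last : Adj G z₀ B.last
    z₀-adj-B-last with B.last∈B
    ... | inj₁ last≡z₀ = ⊥-elim (B-last≢z₀ last≡z₀)
    ... | inj₂ (here z₀-last) = z₀-last

    z₀-adj-A : Any (Adj G z₀) A.vertices
    z₀-adj-A = lose (walk-end∈ A.walk) A.last∈B

    z₀-adj-B : Any (Adj G z₀) B.vertices
    z₀-adj-B = lose (walk-end∈ B.walk) z₀-adj-B-last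

    z₀-degree-A : AtMostNeighbours 1 z₀ A.vertices
    z₀-degree-A = one-neighbour A.last A.B-only-at-last

    z₀-degree-B : AtMostNeighbours 1 z₀ B.vertices
    z₀-degree-B = one-neighbour B.last λ y∈ z₀y → B.B-only-at-last y∈ (inj₂ (here z₀y))

    touching-paths : Any (λ u → Any (Adj G u) B.vertices) A.vertices → Rebranching₃₄₅
    touching-paths A-touches-B = record
      { z = z₀
      ; P = A.vertices
      ; Q = B.vertices
      ; z-right = z₀-right
      ; P-right = A-right
      ; Q-right = B-right
      ; P∩Q≡∅ = A∩B≡∅
      ; z∉P = z₀∉A
      ; z∉Q = z₀∉B
      ; P-connected = walk-connected A.walk
      ; Q-connected = walk-connected B.walk
      ; P-touches-X₂ = here A.first∈A
      ; Q-touches-X₂ = here B.first∈A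
      ; P-touches-Q = A-touches-B
      ; z-adj-P = z₀-adj-A
      ; z-adj-Q = z₀-adj-B
      ; z-apart-X₂ = X₂-apart-X₅ z₀∈X₅
      ; z-degree-P = AtMostNeighbours-≤ (s≤s z≤n) z₀-degree-A
      ; z-degree-Q = AtMostNeighbours-≤ (s≤s z≤n) z₀-degree-B
      }

    module _ (A-apart-B : ¬ Any (λ u → Any (Adj G u) B.vertices) A.vertices)
             (C : InducedPath (X₃ ∪ X₄) N[ A.vertices ] N[ B.vertices ]) where
      private
        module C = InducedPath C

      N[A]∩B≡∅ : ∀ {y} → N[ A.vertices ] y → y ∉ₗ B.vertices
      N[A]∩B≡∅ (inj₁ y∈A) = A∩B≡∅ y∈A
      N[A]∩B≡∅ (inj₂ A-adj-y) y∈B = A-apart-B (Any.map (lose y∈B) A-adj-y)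

      N[B]∩A≡∅ : ∀ {y} → N[ B.vertices ] y → y ∉ₗ A.vertices
      N[B]∩A≡∅ (inj₁ y∈B) y∈A = A∩B≡∅ y∈A y∈B
      N[B]∩A≡∅ (inj₂ B-adj-y) y∈A = A-apart-B (lose y∈A (Any.map Adj-sym B-adj-y))

      C∩A≡∅ : ∀ {y} → y ∈ₗ C.vertices → y ∉ₗ A.vertices
      C∩A≡∅ y∈C y∈A with C.A-only-at-first y∈C (inj₁ y∈A)
      ... | refl = first∉ C (N[B]∩A≡∅ C.last∈B) y∈A

      C∩B≡∅ : ∀ {y} → y ∈ₗ C.vertices → y ∉ₗ B.vertices
      C∩B≡∅ y∈C y∈B with C.B-only-at-last y∈C (inj₁ y∈B)
      ... | refl = last∉ C (N[A]∩B≡∅ C.first∈A) y∈B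

      C-right : ∀ {y} → y ∈ₗ C.vertices → Right y
      C-right y∈C with Subset.x∈p∪q⁻ X₃ X₄ (C.inside y∈C)
      ... | inj₁ y∈X₃ = inj₁ y∈X₃
      ... | inj₂ y∈X₄ = inj₂ (inj₁ y∈X₄)

      z₀∉C : z₀ ∉ₗ C.vertices
      z₀∉C z₀∈C with Subset.x∈p∪q⁻ X₃ X₄ (C.inside z₀∈C)
      ... | inj₁ z₀∈X₃ = disjoint M k3 k5 (λ ()) _ z₀∈X₃ z₀∈X₅
      ... | inj₂ z₀∈X₄ = disjoint M k4 k5 (λ ()) _ z₀∈X₄ z₀∈X₅

      first∉rest : C.first ∉ₗ C.rest
      first∉rest = chordless-∉-suffix [] C.chordless

      first-adj-A : Any (Adj G C.first) A.vertices
      first-adj-A with C.first∈A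
      ... | inj₁ first∈A = ⊥-elim (C∩A≡∅ (here refl) first∈A)
      ... | inj₂ A-adj-first = Any.map Adj-sym A-adj-first

      last-adj-B : Any (Adj G C.last) B.vertices
      last-adj-B with C.last∈B
      ... | inj₁ last∈B = ⊥-elim (C∩B≡∅ (walk-end∈ C.walk) last∈B)
      ... | inj₂ B-adj-last = Any.map Adj-sym B-adj-last

      only-ends-near-z₀ : (∀ {y} → y ∈ₗ C.rest → Adj G z₀ y → y ≡ C.last) → Rebranching₃₄₅
      only-ends-near-z₀ only-last = record
        { z = z₀
        ; P = C.first ∷ A.vertices
        ; Q = C.rest ++ B.vertices
        ; z-right = z₀-right
        ; P-right = λ { (here refl) → C-right (here refl) ; (there y∈A) → A-right y∈A }
        ; Q-right = [ C-right ∘ there , B-right ]′ ∘ ∈-++⁻ C.rest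
        ; P∩Q≡∅ = P∩Q≡∅
        ; z∉P = λ { (here refl) → z₀∉C (here refl) ; (there z₀∈A) → z₀∉A z₀∈A }
        ; z∉Q = [ z₀∉C ∘ there , z₀∉B ]′ ∘ ∈-++⁻ C.rest
        ; P-connected = ∷-connected A.vertices first-adj-A (walk-connected A.walk)
        ; Q-connected = walk-rest-++-connected C.walk last-adj-B (walk-connected B.walk)
        ; P-touches-X₂ = there (here A.first∈A)
        ; Q-touches-X₂ = Any-++⁺ʳ C.rest (here B.first∈A)
        ; P-touches-Q = here (walk-rest-++-touch C.walk last-adj-B)
        ; z-adj-P = there z₀-adj-A
        ; z-adj-Q = Any-++⁺ʳ C.rest z₀-adj-B
        ; z-apart-X₂ = X₂-apart-X₅ z₀∈X₅
        ; z-degree-P = AtMostNeighbours-∷ C.first z₀-degree-A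
        ; z-degree-Q = AtMostNeighbours-++ (one-neighbour C.last only-last) z₀-degree-B
        }
        where
        P∩Q≡∅ : ∀ {y} → y ∈ₗ C.first ∷ A.vertices → y ∉ₗ C.rest ++ B.vertices
        P∩Q≡∅ (here refl) = [ first∉rest , C∩B≡∅ (here refl) ]′ ∘ ∈-++⁻ C.rest
        P∩Q≡∅ (there y∈A) =
          [ (λ y∈rest → C∩A≡∅ (there y∈rest) y∈A) , A∩B≡∅ y∈A ]′ ∘ ∈-++⁻ C.rest

      OtherNeighbour : Pred V 0ℓ
      OtherNeighbour y = Adj G z₀ y × y ≢ C.last

      OtherNeighbour? : Decidable OtherNeighbour
      OtherNeighbour? y = Adj? z₀ y ×-dec ¬? (y Fin.≟ C.last)

      not-other⇒last : ∀ {y} → ¬ OtherNeighbour y → Adj G z₀ y → y ≡ C.last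
      not-other⇒last {y} not-other z₀y =
        decidable-stable (y Fin.≟ C.last) λ y≢last → not-other (z₀y , y≢last)

      module _ {p b β q} (rest≡ : C.rest ≡ p ++ b ∷ β ∷ q)
               (z₀b : Adj G z₀ b) (b≢last : b ≢ C.last)
               (none-after : All (∁ OtherNeighbour) (β ∷ q))
               (bβ : Adj G b β) (w : Walk β q C.last) where

        vertices≡ : C.vertices ≡ (C.first ∷ p) ++ b ∷ β ∷ q
        vertices≡ = cong (C.first ∷_) rest≡

        ch : Chordless (b ∷ β ∷ q)
        ch = chordless-suffix (C.first ∷ p) (subst Chordless vertices≡ C.chordless)

        ⊆C : b ∷ β ∷ q ⊆ₗ C.vertices
        ⊆C = suffix-⊆ (C.first ∷ p) vertices≡

        b∈C : b ∈ₗ C.vertices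
        b∈C = ⊆C (here refl)

        b∉N[A] : ¬ N[ A.vertices ] b
        b∉N[A] b-near-A = first∉rest (subst (_∈ₗ C.rest) (C.A-only-at-first b∈C b-near-A) b∈rest)
          where
          b∈rest : b ∈ₗ C.rest
          b∈rest = subst (b ∈ₗ_) (≡.sym rest≡) (∈-++⁺ʳ p (here refl))

        b∉N[B] : ¬ N[ B.vertices ] b
        b∉N[B] = b≢last ∘ C.B-only-at-last b∈C

        b-replaces-z₀ : ¬ HasNeighbourIn X₂ b → Rebranching₃₄₅
        b-replaces-z₀ b-apart-X₂ = record
          { z = b
          ; P = z₀ ∷ A.vertices
          ; Q = (β ∷ q) ++ B.vertices
          ; z-right = C-right b∈C
          ; P-right = λ { (here refl) → z₀-right ; (there y∈A) → A-right y∈A }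
          ; Q-right = [ C-right ∘ ⊆C ∘ there , B-right ]′ ∘ ∈-++⁻ (β ∷ q)
          ; P∩Q≡∅ = P∩Q≡∅
          ; z∉P = λ { (here refl) → z₀∉C b∈C ; (there b∈A) → C∩A≡∅ b∈C b∈A }
          ; z∉Q = [ chordless-∉-suffix [] ch , C∩B≡∅ b∈C ]′ ∘ ∈-++⁻ (β ∷ q)
          ; P-connected = ∷-connected A.vertices z₀-adj-A (walk-connected A.walk)
          ; Q-connected = walk-rest-++-connected (bβ ∷ w) last-adj-B (walk-connected B.walk)
          ; P-touches-X₂ = there (here A.first∈A)
          ; Q-touches-X₂ = Any-++⁺ʳ (β ∷ q) (here B.first∈A)
          ; P-touches-Q = here (Any-++⁺ʳ (β ∷ q) z₀-adj-B)
          ; z-adj-P = here (Adj-sym z₀b)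
          ; z-adj-Q = here bβ
          ; z-apart-X₂ = b-apart-X₂
          ; z-degree-P = AtMostNeighbours-≤ (s≤s z≤n) (AtMostNeighbours-∷ z₀
              (no-neighbours λ y∈A by → b∉N[A] (inj₂ (lose y∈A (Adj-sym by)))))
          ; z-degree-Q = AtMostNeighbours-≤ (s≤s z≤n) (AtMostNeighbours-++
              (chordless-successor ch)
              (no-neighbours λ y∈B by → b∉N[B] (inj₂ (lose y∈B (Adj-sym by)))))
          }
          where
          P∩Q≡∅ : ∀ {y} → y ∈ₗ z₀ ∷ A.vertices → y ∉ₗ (β ∷ q) ++ B.vertices
          P∩Q≡∅ (here refl) = [ z₀∉C ∘ ⊆C ∘ there , z₀∉B ]′ ∘ ∈-++⁻ (β ∷ q)
          P∩Q≡∅ (there y∈A) =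
            [ (λ y∈ → C∩A≡∅ (⊆C (there y∈)) y∈A) , A∩B≡∅ y∈A ]′ ∘ ∈-++⁻ (β ∷ q)

        bβ-replaces-A : HasNeighbourIn X₂ b → Rebranching₃₄₅
        bβ-replaces-A b-adj-X₂ = record
          { z = z₀
          ; P = b ∷ β ∷ []
          ; Q = q ++ B.vertices
          ; z-right = z₀-right
          ; P-right = C-right ∘ ⊆C ∘ pair⊆
          ; Q-right = [ C-right ∘ ⊆C ∘ there ∘ there , B-right ]′ ∘ ∈-++⁻ q
          ; P∩Q≡∅ = P∩Q≡∅
          ; z∉P = z₀∉C ∘ ⊆C ∘ pair⊆
          ; z∉Q = [ z₀∉C ∘ ⊆C ∘ there ∘ there , z₀∉B ]′ ∘ ∈-++⁻ q
          ; P-connected = walk-connected (bβ ∷ [])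
          ; Q-connected = walk-rest-++-connected w last-adj-B (walk-connected B.walk)
          ; P-touches-X₂ = here b-adj-X₂
          ; Q-touches-X₂ = Any-++⁺ʳ q (here B.first∈A)
          ; P-touches-Q = there (here (walk-rest-++-touch w last-adj-B))
          ; z-adj-P = here z₀b
          ; z-adj-Q = Any-++⁺ʳ q z₀-adj-B
          ; z-apart-X₂ = X₂-apart-X₅ z₀∈X₅
          ; z-degree-P = b ∷ β ∷ [] , ℕ.≤-refl , λ y∈ _ → y∈
          ; z-degree-Q = AtMostNeighbours-++
              (one-neighbour C.last λ y∈q → not-other⇒last (All.lookup none-after (there y∈q)))
              z₀-degree-B
          }
          where
          pair⊆ : b ∷ β ∷ [] ⊆ₗ b ∷ β ∷ q
          pair⊆ = ∷⁺ʳ b (∷⁺ʳ β (λ ()))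

          P∩Q≡∅ : ∀ {y} → y ∈ₗ b ∷ β ∷ [] → y ∉ₗ q ++ B.vertices
          P∩Q≡∅ (here refl) =
            [ chordless-∉-suffix [] ch ∘ there , C∩B≡∅ b∈C ]′ ∘ ∈-++⁻ q
          P∩Q≡∅ (there (here refl)) =
            [ chordless-∉-suffix (b ∷ []) ch , C∩B≡∅ (⊆C (there (here refl))) ]′ ∘ ∈-++⁻ q

      rebranching-via-C : Rebranching₃₄₅
      rebranching-via-C with any? OtherNeighbour? C.rest
      ... | no none = only-ends-near-z₀ λ y∈ → not-other⇒last (none ∘ lose y∈)
      ... | yes some with split-last OtherNeighbour? some
      ...   | p , b , post , rest≡ , (z₀b , b≢last) , none-after
              with walk-suffix (C.first ∷ p) (cong (C.first ∷_) rest≡) C.walk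
      ...     | [] = ⊥-elim (b≢last refl)
      ...     | bβ ∷ w with HasNeighbourIn? X₂ b
      ...       | no b-apart-X₂ = b-replaces-z₀ rest≡ z₀b b≢last none-after bβ w b-apart-X₂
      ...       | yes b-adj-X₂ = bβ-replaces-A rest≡ z₀b b≢last none-after bβ w b-adj-X₂

    B-first∈X₄ : B.first ∈ X₄
    B-first∈X₄ with Subset.x∈p∪q⁻ X₄ X₅ (B.inside (here refl))
    ... | inj₁ first∈X₄ = first∈X₄
    ... | inj₂ first∈X₅ = ⊥-elim (X₂-apart-X₅ first∈X₅ B.first∈A)

    rebranching₃₄₅ : Rebranching₃₄₅
    rebranching₃₄₅ with any? (λ u → any? (Adj? u) B.vertices) A.vertices
    ... | yes A-touches-B = touching-paths A-touches-B
    ... | no A-apart-B with branches-touch k3 k4 (λ ()) refl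
    ...   | e₃ , e₄ , e₃∈X₃ , e₄∈X₄ , e₃e₄ =
      rebranching-via-C A-apart-B
        (induced-path (N[ A.vertices ]?) (N[ B.vertices ]?)
          (Reach-∪ (connected M k3 A.first e₃ (A.inside (here refl)) e₃∈X₃) e₃e₄
                   (connected M k4 e₄ B.first e₄∈X₄ B-first∈X₄))
          (inj₁ (here refl)) (inj₁ (here refl)))

  shrink-branch₅ : Σ (Model 𝕂 G) λ M′ → X M′ k1 ≡ X₁ × X M′ k2 ≡ X₂ × ∣ X M′ k5 ∣ ≡ 1 ×
    ∣ N G (X M′ k5) ∩ X M′ k3 ∣ ≤ 2 × ∣ N G (X M′ k5) ∩ X M′ k4 ∣ ≤ 2
  shrink-branch₅
    with branches-touch k3 k5 (λ ()) refl
       | touch-neighbour (branches-touch k3 k2 (λ ()) refl)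
       | touch-neighbour (branches-touch k4 k2 (λ ()) refl)
       | branches-touch k4 k5 (λ ()) refl
  ... | a , z₀ , a∈X₃ , z₀∈X₅ , az₀
      | s , s∈X₃ , s-adj-X₂
      | t , t∈X₄ , t-adj-X₂
      | e₄ , e₅ , e₄∈X₄ , e₅∈X₅ , e₄e₅ =
    rebranch₃₄₅ (rebranching₃₄₅ z₀∈X₅
      (induced-path (HasNeighbourIn? X₂) (Adj? z₀)
        (connected M k3 s a s∈X₃ a∈X₃) s-adj-X₂ (Adj-sym az₀))
      (induced-path (HasNeighbourIn? X₂) (N[ z₀ ∷ [] ]?)
        (Reach-∪ (connected M k4 t e₄ t∈X₄ e₄∈X₄) e₄e₅ (connected M k5 e₅ z₀ e₅∈X₅ z₀∈X₅))
        t-adj-X₂ (inj₁ (here refl))))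

lemma6 : (G : Graph) → InducedMinor 𝕂 G →
    Σ (Model 𝕂 G) λ M →
      (∣ X M k1 ∣ ≡ 1) × (∣ X M k5 ∣ ≡ 1) ×
      (∣ N G (X M k1) ∩ X M k2 ∣ ≤ 3) ×
      (∣ N G (X M k5) ∩ X M k3 ∣ ≤ 2) ×
      (∣ N G (X M k5) ∩ X M k4 ∣ ≤ 2)
lemma6 G M =
  let M₁ , ∣X₁∣≡1 , deg₁ = shrink-branch₁ M
      M₂ , X₁≡ , X₂≡ , ∣X₅∣≡1 , deg₃ , deg₄ = shrink-branch₅ M₁
  in M₂ , subst (λ S → ∣ S ∣ ≡ 1) (≡.sym X₁≡) ∣X₁∣≡1 , ∣X₅∣≡1 ,
     subst₂ (λ S T → ∣ N G S ∩ T ∣ ≤ 3) (≡.sym X₁≡) (≡.sym X₂≡) deg₁ , deg₃ , deg₄
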